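{- Let $\Gamma$ be a finite simple graph, $\tilde\Gamma$ the prime graph of $SEP(\Gamma)$, $p_n$ the $n$-th prime, and $k\ge2$ an integer. If $\Gamma$ has at least two structural equivalence classes, with $\alpha$ the size of a largest class and $\beta$ the size of a second largest class, then $\tilde\Gamma$ has a $k$-clique if and only if $\alpha\ge p_k+p_{k-1}$, or $\alpha\ge p_k$ and $\beta\ge p_{k-1}$. If $\Gamma$ has exactly one structural equivalence class, of size $\alpha$, then $\tilde\Gamma$ has a $k$-clique if and only if $\alpha\ge p_k+p_{k-1}$.
   Context: Two vertices $u,v$ of a graph $\Gamma$ are structurally equivalent if the transposition $(u\,v)$ (swapping $u,v$, fixing other vertices) is an automorphism of $\Gamma$; this is an equivalence relation whose classes are the structural equivalence classes. $SEP(\Gamma)=\langle\{(u\,v) : (u\,v)\in \mathrm{Aut}(\Gamma)\}\rangle$, which is isomorphic to the direct product of the symmetric groups on the classes. The prime graph of a finite group $G$ has as vertices the primes dividing $|G|$, distinct primes $p,q$ being adjacent iff $G$ has an element of order $pq$. -}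

module Defs where

open import Data.Nat using (ℕ; zero; suc; _+_; _*_; _∸_; _<_; _≤_; _≥_)
open import Data.Nat.Primality using (Prime; prime?)
open import Data.Nat.Divisibility using (_∣_)
open import Data.Bool using (Bool; false)
import Data.Bool.Properties as BoolP
open import Data.Fin using (Fin)
import Data.Fin.Properties as FinP
open import Data.Fin.Permutation using (Permutation′; _⟨$⟩ʳ_; _∘ₚ_; transpose; _≈_) renaming (id to idₚ)
open import Data.List using (List; length; filter; allFin; upTo)
open import Data.List.Relation.Unary.All using (All)
open import Data.List.Relation.Unary.Any using (Any)
open import Data.List.Relation.Unary.AllPairs using (AllPairs)
open import Data.Product using (Σ; _×_; ∃)
open import Relation.Nullary using (¬_; Dec)
open import Relation.Nullary.Decidable using (map′)
open import Relation.Binary.PropositionalEquality using (_≡_; _≢_)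

record SimpleGraph (n : ℕ) : Set where
  field
    Adj     : Fin n → Fin n → Bool
    symAdj  : ∀ x y → Adj x y ≡ Adj y x
    loopless : ∀ x → Adj x x ≡ false
open SimpleGraph public

IsAut : ∀ {n} → SimpleGraph n → Permutation′ n → Set
IsAut Γ σ = ∀ x y → Adj Γ x y ≡ Adj Γ (σ ⟨$⟩ʳ x) (σ ⟨$⟩ʳ y)

isAut? : ∀ {n} (Γ : SimpleGraph n) (σ : Permutation′ n) → Dec (IsAut Γ σ)
isAut? Γ σ = FinP.all? (λ x → FinP.all? (λ y →
  Adj Γ x y BoolP.≟ Adj Γ (σ ⟨$⟩ʳ x) (σ ⟨$⟩ʳ y)))

StructEq : ∀ {n} → SimpleGraph n → Fin n → Fin n → Set
StructEq Γ u v = IsAut Γ (transpose u v)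

structEq? : ∀ {n} (Γ : SimpleGraph n) u v → Dec (StructEq Γ u v)
structEq? Γ u v = isAut? Γ (transpose u v)

classSize : ∀ {n} → SimpleGraph n → Fin n → ℕ
classSize {n} Γ u = length (filter (structEq? Γ u) (allFin n))

-- SEP(Γ): the subgroup of Sym(Fin n) generated by the transpositions
-- that are automorphisms of Γ.  Since the group is finite and the
-- generators are involutions, it consists exactly of the finite products
-- of such transpositions (the empty product being the identity).

data InSEP {n} (Γ : SimpleGraph n) : Permutation′ n → Set where
  sep-id   : InSEP Γ idₚ
  sep-step : ∀ {σ} u v → IsAut Γ (transpose u v) → InSEP Γ σ →
             InSEP Γ (σ ∘ₚ transpose u v)

_^ₚ_ : ∀ {n} → Permutation′ n → ℕ → Permutation′ n
σ ^ₚ zero  = idₚ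
σ ^ₚ suc m = σ ∘ₚ (σ ^ₚ m)

HasOrder : ∀ {n} → Permutation′ n → ℕ → Set
HasOrder σ m = (0 < m) × ((σ ^ₚ m) ≈ idₚ) × (∀ j → 0 < j → j < m → ¬ ((σ ^ₚ j) ≈ idₚ))

-- Order of the group SEP(Γ): L is a duplicate-free list (up to equality
-- of permutations) whose members are exactly the elements of SEP(Γ);
-- |SEP(Γ)| = length L.

EnumeratesSEP : ∀ {n} → SimpleGraph n → List (Permutation′ n) → Set
EnumeratesSEP Γ L =
  All (InSEP Γ) L ×
  (∀ σ → InSEP Γ σ → Any (λ τ → σ ≈ τ) L) ×
  AllPairs (λ σ τ → ¬ (σ ≈ τ)) L

DividesOrderSEP : ∀ {n} → SimpleGraph n → ℕ → Set
DividesOrderSEP Γ p = ∃ λ L → EnumeratesSEP Γ L × p ∣ length L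

PGVertex : ∀ {n} → SimpleGraph n → ℕ → Set
PGVertex Γ p = Prime p × DividesOrderSEP Γ p

PGEdge : ∀ {n} → SimpleGraph n → ℕ → ℕ → Set
PGEdge Γ p q = p ≢ q × ∃ λ σ → InSEP Γ σ × HasOrder σ (p * q)

HasClique : ∀ {n} → SimpleGraph n → ℕ → Set
HasClique Γ k = Σ (Fin k → ℕ) λ f →
  (∀ i → PGVertex Γ (f i)) ×
  (∀ i j → i ≢ j → PGEdge Γ (f i) (f j))

-- The k-th prime (1-indexed: p₁ = 2, p₂ = 3, ...):
-- p is prime and exactly k-1 primes are smaller than p.

primesBelow : ℕ → ℕ
primesBelow m = length (filter prime? (upTo m))

IsNthPrime : ℕ → ℕ → Set
IsNthPrime k p = Prime p × suc (primesBelow p) ≡ k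

-- Every element of SEP(Γ) maps each vertex into its own structural equivalence class, and
-- conversely every class-preserving permutation is a product of transpositions inside classes.
-- If σ ∈ SEP(Γ) has order pq (p ≠ q primes), some x is moved by σ^q, so the cycle of x has
-- length d with p ∣ d; likewise some y lies on a cycle of length e with q ∣ e.  Cycles stay
-- inside classes, so either x and y lie in different classes of sizes ≥ p and ≥ q, or their
-- common class contains a cycle of length divisible by pq, or two disjoint cycles of lengths
-- ≥ p and ≥ q; in both cases it has ≥ p + q vertices.  Conversely, disjoint p- and q-cycles
-- inside classes give an element of order pq, and a p-cycle gives p ∣ |SEP(Γ)| by Lagrange.
-- As the primes up to p_k are p_k and the primes up to p_{k-1}, a k-clique exists iff the
-- prime graph has an edge between p' ≥ p_k and q' ≥ p_{k-1}, i.e. iff some class has at least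
-- p_k + p_{k-1} vertices or two classes have at least p_k and p_{k-1} vertices respectively.

module Submission where

open import Defs
open import Level using (0ℓ)
open import Data.Nat using (ℕ; zero; suc; _+_; _*_; _∸_; _≤_; _<_; z≤n; s≤s; _<?_)
open import Data.Nat.Base using (>-nonZero; nonTrivial⇒n>1)
open import Data.Nat.Properties using (*-comm; +-comm; +-mono-≤; +-monoˡ-≤; +-suc; <-irrefl; <-trans; <-≤-trans;
  <⇒≤; <⇒≱; ≤-<-trans; ≤-antisym; ≤-pred; ≤-refl; ≤-reflexive; ≤-trans; ≮⇒≥; ≰⇒>; anyUpTo?; m+[n∸m]≡n;
  m+n≤o⇒m≤o; m+n≤o⇒m≤o∸n; m<m*n; m<n⇒0<n∸m; m∸n≤m; m≤m+n; m≤n⇒m<n∨m≡n; m≤n⇒m≤1+n; m≤n⇒m⊓n≡m;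
  module ≤-Reasoning)
open import Data.Nat.Induction using (<-rec)
open import Data.Nat.Divisibility using (_∣_; divides; _∣?_; ∣⇒≤; ∣-refl; ∣-trans; ∣m∣n⇒∣m+n)
open import Data.Nat.DivMod using (_%_; _/_; m≡m%n+[m/n]*n; m%n<n)
open import Data.Nat.Primality using (Prime; prime; prime?; prime⇒nonZero; euclidsLemma; prime⇒irreducible)
open import Data.Nat.Coprimality using (Coprime; coprime-divisor)
open import Data.Nat.Solver using (module +-*-Solver)
open import Data.Fin using (Fin; zero; suc; punchIn)
open import Data.Fin.Properties using (_≟_; all?; ¬∀⟶∃¬; punchIn-injective)
import Data.Fin.Permutation.Components as PC
open import Data.Fin.Permutation using (Permutation′; _⟨$⟩ʳ_; _⟨$⟩ˡ_; _∘ₚ_; transpose; _≈_; inverseˡ; inverseʳ;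
  insert; remove; insert-punchIn; insert-remove) renaming (id to idₚ)
open import Data.List using (List; []; _∷_; [_]; _++_; length; filter; take; drop; lookup; allFin; upTo; applyUpTo;
  cartesianProductWith)
open import Data.List.Properties using (length-removeAt′; length-take; length-drop; length-++; length-applyUpTo;
  length-tabulate; filter-≐)
open import Data.List.Relation.Unary.Any as Any using (Any; here; there; index; _─_)
open import Data.List.Relation.Unary.All as All using (All; []; _∷_)
import Data.List.Relation.Unary.All.Properties as All
open import Data.List.Relation.Unary.All.Properties using (All¬⇒¬Any; all-filter)
open import Data.List.Relation.Unary.AllPairs using (AllPairs; []; _∷_)
open import Data.List.Membership.Propositional using (_∈_; _∉_)
open import Data.List.Membership.Propositional.Properties using (∈-++⁺ˡ; ∈-++⁻; ∈-allFin; ∈-applyUpTo⁻; ∈-filter⁺;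
  ∈-filter⁻; ∈-upTo⁺; ∈-upTo⁻; ∈-lookup; ∈-tabulate⁻)
open import Data.List.Relation.Unary.Unique.Propositional using (Unique)
import Data.List.Relation.Unary.Unique.Propositional.Properties as Unique
open import Data.List.Relation.Binary.Disjoint.Propositional using (Disjoint)
import Data.List.Membership.Setoid as SetoidMembership
import Data.List.Membership.Setoid.Properties as SetoidMembershipProps
import Data.List.Relation.Binary.Subset.Setoid as SetoidSubset
import Data.List.Relation.Unary.Unique.Setoid as SetoidUnique
import Data.List.Relation.Unary.Unique.Setoid.Properties as SetoidUniqueProps
open import Data.Product using (_×_; _,_; ∃; ∃₂; proj₁; proj₂)
open import Data.Sum using (_⊎_; inj₁; inj₂)
open import Data.Unit using (⊤; tt)
open import Function using (_∘_)
open import Function.Bundles using (_⇔_; mk⇔)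
open import Function.Construct.Composition using () renaming (equivalence to ⇔-trans)
open import Relation.Binary.Bundles using (Setoid)
open import Relation.Binary.Definitions using (Decidable)
open import Relation.Binary.PropositionalEquality using (_≡_; _≢_; refl; sym; trans; cong; cong₂; subst; setoid;
  module ≡-Reasoning)
open import Relation.Nullary using (¬_; Dec; yes; no; contradiction)
open import Relation.Nullary.Decidable using (_×-dec_; _⊎-dec_)
import Relation.Unary as U
open import Relation.Unary.Properties using (∁?)

module _ {c ℓ} (S : Setoid c ℓ) where
  open Setoid S using () renaming (_≈_ to _≈ₛ_; sym to ≈-sym; trans to ≈-trans)
  open SetoidMembership S using () renaming (_∈_ to _∈ₛ_)
  open SetoidSubset S using () renaming (_⊆_ to _⊆ₛ_)
  open SetoidUnique S using () renaming (Unique to Uniqueₛ)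

  private
    ∈-─⁺ : ∀ {x y ys} (x∈ys : x ∈ₛ ys) → y ∈ₛ ys → ¬ y ≈ₛ x → y ∈ₛ (ys ─ x∈ys)
    ∈-─⁺ (here x≈z) (here y≈z) y≉x = contradiction (≈-trans y≈z (≈-sym x≈z)) y≉x
    ∈-─⁺ (here _)   (there y∈) _   = y∈
    ∈-─⁺ (there _)  (here y≈z) _   = here y≈z
    ∈-─⁺ (there x∈) (there y∈) y≉x = there (∈-─⁺ x∈ y∈ y≉x)

  Unique⇒length-mono-⊆ : ∀ {xs ys} → Uniqueₛ xs → xs ⊆ₛ ys → length xs ≤ length ys
  Unique⇒length-mono-⊆ {[]}     _          _   = z≤n
  Unique⇒length-mono-⊆ {x ∷ xs} {ys} (x≉xs ∷ u) sub = begin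
    suc (length xs)          ≤⟨ s≤s (Unique⇒length-mono-⊆ u sub′) ⟩
    suc (length (ys ─ x∈ys)) ≡⟨ sym (length-removeAt′ ys (index x∈ys)) ⟩
    length ys                ∎
    where
    open ≤-Reasoning
    x∈ys = sub (here (Setoid.refl S))
    sub′ : xs ⊆ₛ (ys ─ x∈ys)
    sub′ y∈xs = ∈-─⁺ x∈ys (sub (there y∈xs))
      λ y≈x → All¬⇒¬Any x≉xs (SetoidMembershipProps.∈-resp-≈ S y≈x y∈xs)

module _ {a} {A : Set a} where

  ∈-take⁻ : ∀ m {xs : List A} {v} → v ∈ take m xs → v ∈ xs
  ∈-take⁻ (suc m) {_ ∷ _} (here v≡x) = here v≡x
  ∈-take⁻ (suc m) {_ ∷ _} (there v∈) = there (∈-take⁻ m v∈)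

  ∈-drop⁻ : ∀ m {xs : List A} {v} → v ∈ drop m xs → v ∈ xs
  ∈-drop⁻ zero             v∈ = v∈
  ∈-drop⁻ (suc m) {_ ∷ _} v∈ = there (∈-drop⁻ m v∈)

  take-drop-disjoint : ∀ m {xs : List A} → Unique xs → Disjoint (take m xs) (drop m xs)
  take-drop-disjoint (suc m) {_ ∷ xs} (x∉xs ∷ _) (here refl , v∈) = All¬⇒¬Any x∉xs (∈-drop⁻ m v∈)
  take-drop-disjoint (suc m) {_ ∷ xs} (_ ∷ u) (there v∈ , v∈′) = take-drop-disjoint m u (v∈ , v∈′)

  length-take-≤ : ∀ {m} {xs : List A} → m ≤ length xs → length (take m xs) ≡ m
  length-take-≤ {m} {xs} m≤ = trans (length-take m xs) (m≤n⇒m⊓n≡m m≤)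

length-filter-∁ : ∀ {a p} {A : Set a} {P : U.Pred A p} (P? : U.Decidable P) xs →
                  length (filter P? xs) + length (filter (∁? P?) xs) ≡ length xs
length-filter-∁ P? []       = refl
length-filter-∁ P? (x ∷ xs) with P? x
... | yes _ = cong suc (length-filter-∁ P? xs)
... | no _  = trans (+-suc _ _) (cong suc (length-filter-∁ P? xs))

lookup-injective : ∀ {a} {A : Set a} {xs : List A} → Unique xs → ∀ {i j} →
                   lookup xs i ≡ lookup xs j → i ≡ j
lookup-injective {xs = _ ∷ _}  _          {zero}  {zero}  _  = refl
lookup-injective {xs = _ ∷ xs} (x∉xs ∷ _) {zero}  {suc j} eq =
  contradiction (subst (_∈ xs) (sym eq) (∈-lookup j)) (All¬⇒¬Any x∉xs)
lookup-injective {xs = _ ∷ xs} (x∉xs ∷ _) {suc i} {zero}  eq =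
  contradiction (subst (_∈ xs) eq (∈-lookup i)) (All¬⇒¬Any x∉xs)
lookup-injective {xs = _ ∷ _}  (_ ∷ xs!)  {suc i} {suc j} eq = cong suc (lookup-injective xs! eq)

injection⇒≤length : ∀ {a} {A : Set a} {m} {xs : List A} (f : Fin m → A) →
                    (∀ {i j} → f i ≡ f j → i ≡ j) → (∀ i → f i ∈ xs) → m ≤ length xs
injection⇒≤length {m = m} {xs} f f-inj f∈xs = subst (_≤ length xs) (length-tabulate f)
  (Unique⇒length-mono-⊆ (setoid _) {ys = xs} (Unique.tabulate⁺ f-inj) λ v∈ →
    let i , v≡fi = ∈-tabulate⁻ v∈ in subst (_∈ xs) (sym v≡fi) (f∈xs i))

least-positive : ∀ {p} {P : U.Pred ℕ p} → U.Decidable P → ∀ {N} → 0 < N → P N →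
                 ∃ λ d → 0 < d × P d × (∀ r → 0 < r → r < d → ¬ P r)
least-positive {P = P} P? {N} = <-rec Goal go N
  where
  Goal : ℕ → Set _
  Goal N = 0 < N → P N → ∃ λ d → 0 < d × P d × (∀ r → 0 < r → r < d → ¬ P r)
  go : ∀ N → (∀ {r} → r < N → Goal r) → Goal N
  go N rec 0<N pN with anyUpTo? (λ r → (0 <? r) ×-dec P? r) N
  ... | yes (r , r<N , 0<r , pr) = rec r<N 0<r pr
  ... | no none = N , 0<N , pN , λ r 0<r r<N pr → none (r , r<N , 0<r , pr)

prime⇒2≤ : ∀ {p} → Prime p → 2 ≤ p
prime⇒2≤ {p} (prime {{nt}} _) = nonTrivial⇒n>1 p {{nt}}

m+n≤m*n : ∀ {m n} → 2 ≤ m → 2 ≤ n → m + n ≤ m * n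
m+n≤m*n {suc (suc a)} {suc (suc b)} (s≤s (s≤s z≤n)) (s≤s (s≤s z≤n)) =
  subst (2 + a + (2 + b) ≤_) (eq a b) (m≤m+n _ _)
  where
  open +-*-Solver
  eq : ∀ a b → 2 + a + (2 + b) + (a + b + a * b) ≡ (2 + a) * (2 + b)
  eq = solve 2 (λ a b → con 2 :+ a :+ (con 2 :+ b) :+ (a :+ b :+ a :* b) := (con 2 :+ a) :* (con 2 :+ b)) refl

∣m*p⇒∣m⊎p∣ : ∀ {d m p} → Prime p → d ∣ m * p → d ∣ m ⊎ p ∣ d
∣m*p⇒∣m⊎p∣ {d} {m} {p} pp d∣mp with p ∣? d
... | yes p∣d = inj₂ p∣d
... | no p∤d  = inj₁ (coprime-divisor coprime (subst (d ∣_) (*-comm m p) d∣mp))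
  where
  coprime : Coprime d p
  coprime (i∣d , i∣p) with prime⇒irreducible pp i∣p
  ... | inj₁ i≡1  = i≡1
  ... | inj₂ refl = contradiction i∣d p∤d

distinct-primes-∣⇒*-∣ : ∀ {p q d} → Prime p → Prime q → p ≢ q → p ∣ d → q ∣ d → p * q ∣ d
distinct-primes-∣⇒*-∣ {p} {q} pp pq p≢q (divides r refl) q∣rp with euclidsLemma r p pq q∣rp
... | inj₁ (divides s refl) = divides s (solve 3 (λ s q p → (s :* q) :* p := s :* (p :* q)) refl s q p)
  where open +-*-Solver
... | inj₂ q∣p with prime⇒irreducible pp q∣p
...   | inj₁ refl = contradiction (prime⇒2≤ pq) λ { (s≤s ()) }
...   | inj₂ q≡p  = contradiction (sym q≡p) p≢q

-- Structural equivalence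

transpose-matchˡ : ∀ {n} (i j : Fin n) → PC.transpose i j i ≡ j
transpose-matchˡ i j with i ≟ i
... | yes _  = refl
... | no i≢i = contradiction refl i≢i

transpose-matchʳ : ∀ {n} (i j : Fin n) → PC.transpose i j j ≡ i
transpose-matchʳ i j with j ≟ i
... | yes j≡i = j≡i
... | no _ with j ≟ j
...   | yes _  = refl
...   | no j≢j = contradiction refl j≢j

transpose-mismatch : ∀ {n} {i j k : Fin n} → k ≢ i → k ≢ j → PC.transpose i j k ≡ k
transpose-mismatch {i = i} {j} {k} k≢i k≢j with k ≟ i
... | yes k≡i = contradiction k≡i k≢i
... | no _ with k ≟ j
...   | yes k≡j = contradiction k≡j k≢j
...   | no _    = refl

data TransposeView {n} (i j : Fin n) : Fin n → Fin n → Set where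
  at-i  : TransposeView i j i j
  at-j  : TransposeView i j j i
  other : ∀ {k} → k ≢ i → k ≢ j → TransposeView i j k k

transpose-view : ∀ {n} (i j k : Fin n) → TransposeView i j k (PC.transpose i j k)
transpose-view i j k = view (k ≟ i) (k ≟ j)
  where
  view : Dec (k ≡ i) → Dec (k ≡ j) → TransposeView i j k (PC.transpose i j k)
  view (yes refl) _          = subst (TransposeView i j k) (sym (transpose-matchˡ i j)) at-i
  view (no _)     (yes refl) = subst (TransposeView i j k) (sym (transpose-matchʳ i j)) at-j
  view (no k≢i)   (no k≢j)   =
    subst (TransposeView i j k) (sym (transpose-mismatch k≢i k≢j)) (other k≢i k≢j)

module _ {n} (Γ : SimpleGraph n) where

  SameNeighbours : Fin n → Fin n → Set
  SameNeighbours u v = ∀ x → x ≢ u → x ≢ v → Adj Γ u x ≡ Adj Γ v x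

  StructEq⇒SameNeighbours : ∀ {u v} → StructEq Γ u v → SameNeighbours u v
  StructEq⇒SameNeighbours {u} {v} u~v x x≢u x≢v =
    trans (u~v u x) (cong₂ (Adj Γ) (transpose-matchˡ u v) (transpose-mismatch x≢u x≢v))

  SameNeighbours⇒StructEq : ∀ {u v} → SameNeighbours u v → StructEq Γ u v
  SameNeighbours⇒StructEq {u} {v} same x y
    with PC.transpose u v x | transpose-view u v x | PC.transpose u v y | transpose-view u v y
  ... | _ | at-i          | _ | at-i          = trans (loopless Γ u) (sym (loopless Γ v))
  ... | _ | at-i          | _ | at-j          = symAdj Γ u v
  ... | _ | at-i          | _ | other y≢u y≢v = same y y≢u y≢v
  ... | _ | at-j          | _ | at-i          = symAdj Γ v u
  ... | _ | at-j          | _ | at-j          = trans (loopless Γ v) (sym (loopless Γ u))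
  ... | _ | at-j          | _ | other y≢u y≢v = sym (same y y≢u y≢v)
  ... | _ | other x≢u x≢v | _ | at-i          =
    trans (symAdj Γ x u) (trans (same x x≢u x≢v) (symAdj Γ v x))
  ... | _ | other x≢u x≢v | _ | at-j          =
    trans (symAdj Γ x v) (trans (sym (same x x≢u x≢v)) (symAdj Γ u x))
  ... | _ | other _ _     | _ | other _ _     = refl

  structEq-refl : ∀ u → StructEq Γ u u
  structEq-refl u = SameNeighbours⇒StructEq (λ _ _ _ → refl)

  structEq-sym : ∀ {u v} → StructEq Γ u v → StructEq Γ v u
  structEq-sym u~v =
    SameNeighbours⇒StructEq (λ x x≢v x≢u → sym (StructEq⇒SameNeighbours u~v x x≢u x≢v))

  structEq-trans : ∀ {u v w} → StructEq Γ u v → StructEq Γ v w → StructEq Γ u w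
  structEq-trans {u} {v} {w} u~v v~w = SameNeighbours⇒StructEq same
    where
    same : SameNeighbours u w
    same x x≢u x≢w with x ≟ v
    ... | no x≢v =
      trans (StructEq⇒SameNeighbours u~v x x≢u x≢v) (StructEq⇒SameNeighbours v~w x x≢v x≢w)
    ... | yes refl with u ≟ w
    ...   | yes refl = refl
    ...   | no u≢w   = begin
      Adj Γ u x ≡⟨ symAdj Γ u x ⟩
      Adj Γ x u ≡⟨ StructEq⇒SameNeighbours v~w u (x≢u ∘ sym) u≢w ⟩
      Adj Γ w u ≡⟨ symAdj Γ w u ⟩
      Adj Γ u w ≡⟨ StructEq⇒SameNeighbours u~v w (u≢w ∘ sym) (x≢w ∘ sym) ⟩
      Adj Γ x w ≡⟨ symAdj Γ x w ⟩
      Adj Γ w x ∎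
      where open ≡-Reasoning

  structEq-transpose : ∀ {u v} → StructEq Γ u v → ∀ y → StructEq Γ y (PC.transpose u v y)
  structEq-transpose {u} {v} u~v y with PC.transpose u v y | transpose-view u v y
  ... | _ | at-i      = u~v
  ... | _ | at-j      = structEq-sym u~v
  ... | _ | other _ _ = structEq-refl y

  PreservesClasses : Permutation′ n → Set
  PreservesClasses σ = ∀ x → StructEq Γ x (σ ⟨$⟩ʳ x)

  InSEP⇒PreservesClasses : ∀ {σ} → InSEP Γ σ → PreservesClasses σ
  InSEP⇒PreservesClasses sep-id y = structEq-refl y
  InSEP⇒PreservesClasses (sep-step {σ} u v u~v σ∈SEP) y =
    structEq-trans (InSEP⇒PreservesClasses σ∈SEP y) (structEq-transpose u~v (σ ⟨$⟩ʳ y))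

  class : Fin n → List (Fin n)
  class u = filter (structEq? Γ u) (allFin n)

  class-unique : ∀ u → Unique (class u)
  class-unique u = Unique.filter⁺ (structEq? Γ u) (Unique.allFin⁺ n)

  class-structEq : ∀ u → All (StructEq Γ u) (class u)
  class-structEq u = all-filter (structEq? Γ u) (allFin n)

  length≤classSize : ∀ {u xs} → Unique xs → All (StructEq Γ u) xs → length xs ≤ classSize Γ u
  length≤classSize {u} xs! u~xs =
    Unique⇒length-mono-⊆ (setoid (Fin n)) xs! λ x∈xs →
      ∈-filter⁺ (structEq? Γ u) (∈-allFin _) (All.lookup u~xs x∈xs)

  classSize-resp : ∀ {u v} → StructEq Γ u v → classSize Γ u ≡ classSize Γ v
  classSize-resp u~v = cong length (filter-≐ (structEq? Γ _) (structEq? Γ _)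
    ((λ u~x → structEq-trans (structEq-sym u~v) u~x) , structEq-trans u~v) (allFin n))

-- Powers, periods and orbits of a permutation

⟨$⟩ʳ-injective : ∀ {n} (σ : Permutation′ n) {x y} → σ ⟨$⟩ʳ x ≡ σ ⟨$⟩ʳ y → x ≡ y
⟨$⟩ʳ-injective σ eq = trans (sym (inverseˡ σ)) (trans (cong (σ ⟨$⟩ˡ_) eq) (inverseˡ σ))

module _ {n} (σ : Permutation′ n) where

  pow : ℕ → Fin n → Fin n
  pow m x = (σ ^ₚ m) ⟨$⟩ʳ x

  pow-+ : ∀ a b x → pow (a + b) x ≡ pow b (pow a x)
  pow-+ zero    b x = refl
  pow-+ (suc a) b x = pow-+ a b (σ ⟨$⟩ʳ x)

  pow-comm : ∀ a b x → pow a (pow b x) ≡ pow b (pow a x)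
  pow-comm a b x = begin
    pow a (pow b x) ≡⟨ pow-+ b a x ⟨
    pow (b + a) x   ≡⟨ cong (λ m → pow m x) (+-comm b a) ⟩
    pow (a + b) x   ≡⟨ pow-+ a b x ⟩
    pow b (pow a x) ∎
    where open ≡-Reasoning

  pow-*-fixed : ∀ {d x} → pow d x ≡ x → ∀ t → pow (t * d) x ≡ x
  pow-*-fixed         _    zero    = refl
  pow-*-fixed {d} {x} d-fx (suc t) =
    trans (pow-+ d (t * d) x) (trans (cong (pow (t * d)) d-fx) (pow-*-fixed d-fx t))

  pow-∣-fixed : ∀ {d x} → pow d x ≡ x → ∀ {j} → d ∣ j → pow j x ≡ x
  pow-∣-fixed d-fx (divides t refl) = pow-*-fixed d-fx t

  pow-injective : ∀ m {x y} → pow m x ≡ pow m y → x ≡ y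
  pow-injective zero    eq = eq
  pow-injective (suc m) eq = ⟨$⟩ʳ-injective σ (pow-injective m eq)

  pow-fixed : ∀ {z} → σ ⟨$⟩ʳ z ≡ z → ∀ m → pow m z ≡ z
  pow-fixed     _   zero    = refl
  pow-fixed {z} σz≡z (suc m) = trans (cong (pow m) σz≡z) (pow-fixed σz≡z m)

  IsPeriod : Fin n → ℕ → Set
  IsPeriod x d = 0 < d × pow d x ≡ x × (∀ r → 0 < r → r < d → pow r x ≢ x)

  period-∣ : ∀ {x d} → IsPeriod x d → ∀ {j} → pow j x ≡ x → d ∣ j
  period-∣ {x} {d@(suc _)} (_ , d-fx , minimal) {j} j-fx
    with j % d | m%n<n j d | m≡m%n+[m/n]*n j d
  ... | zero  | _   | j≡ = divides (j / d) j≡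
  ... | suc r | r<d | j≡ = contradiction r-fx (minimal (suc r) (s≤s z≤n) r<d)
    where
    open ≡-Reasoning
    r-fx : pow (suc r) x ≡ x
    r-fx = begin
      pow (suc r) x                   ≡⟨ cong (pow (suc r)) (pow-*-fixed d-fx (j / d)) ⟨
      pow (suc r) (pow (j / d * d) x) ≡⟨ pow-comm (suc r) (j / d * d) x ⟩
      pow (j / d * d) (pow (suc r) x) ≡⟨ pow-+ (suc r) (j / d * d) x ⟨
      pow (suc r + j / d * d) x       ≡⟨ cong (λ m → pow m x) j≡ ⟨
      pow j x                         ≡⟨ j-fx ⟩
      x                               ∎

  period-exists : ∀ {x N} → 0 < N → pow N x ≡ x → ∃ (IsPeriod x)
  period-exists {x} 0<N N-fx with least-positive (λ r → pow r x ≟ x) 0<N N-fx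
  ... | d , 0<d , d-fx , minimal = d , 0<d , d-fx , minimal

  hasOrder-intro : ∀ {m} → 0 < m → (∀ x → pow m x ≡ x) →
                   (∀ j → 0 < j → (∀ x → pow j x ≡ x) → m ∣ j) → HasOrder σ m
  hasOrder-intro 0<m m-fixes m∣ =
    0<m , m-fixes , λ j 0<j j<m j-fixes → <⇒≱ j<m (∣⇒≤ {{>-nonZero 0<j}} (m∣ j 0<j j-fixes))

  hasOrder⇒moved : ∀ {m j} → HasOrder σ m → 0 < j → j < m → ∃ λ x → pow j x ≢ x
  hasOrder⇒moved {j = j} (_ , _ , minimal) 0<j j<m =
    ¬∀⟶∃¬ n (λ x → pow j x ≡ x) (λ x → pow j x ≟ x) (minimal j 0<j j<m)

  orbit : Fin n → ℕ → List (Fin n)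
  orbit x d = applyUpTo (λ i → pow i x) d

  orbit-unique : ∀ {x d} → IsPeriod x d → Unique (orbit x d)
  orbit-unique {x} {d} (_ , _ , minimal) = Unique.applyUpTo⁺₁ _ d λ {i} {j} i<j j<d pᵢ≡pⱼ →
    minimal (j ∸ i) (m<n⇒0<n∸m i<j) (≤-<-trans (m∸n≤m j i) j<d) (pow-injective i (begin
      pow i (pow (j ∸ i) x) ≡⟨ pow-comm i (j ∸ i) x ⟩
      pow (j ∸ i) (pow i x) ≡⟨ pow-+ i (j ∸ i) x ⟨
      pow (i + (j ∸ i)) x   ≡⟨ cong (λ m → pow m x) (m+[n∸m]≡n (<⇒≤ i<j)) ⟩
      pow j x               ≡⟨ pᵢ≡pⱼ ⟨
      pow i x               ∎))
    where open ≡-Reasoning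

  -- y lies on the orbit of x, which σ^d fixes pointwise.
  meeting-orbits-fixed : ∀ {x y d e i j} → pow d x ≡ x → pow e y ≡ y → j < e →
                         pow i x ≡ pow j y → pow d y ≡ y
  meeting-orbits-fixed {x} {y} {d} {e} {i} {j} d-fx e-fy j<e pᵢx≡pⱼy = begin
    pow d y         ≡⟨ cong (pow d) y≡ ⟩
    pow d (pow m x) ≡⟨ pow-comm d m x ⟩
    pow m (pow d x) ≡⟨ cong (pow m) d-fx ⟩
    pow m x         ≡⟨ y≡ ⟨
    y               ∎
    where
    open ≡-Reasoning
    m = i + (e ∸ j)
    y≡ : y ≡ pow m x
    y≡ = begin
      y                       ≡⟨ e-fy ⟨
      pow e y                 ≡⟨ cong (λ k → pow k y) (m+[n∸m]≡n (<⇒≤ j<e)) ⟨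
      pow (j + (e ∸ j)) y     ≡⟨ pow-+ j (e ∸ j) y ⟩
      pow (e ∸ j) (pow j y)   ≡⟨ cong (pow (e ∸ j)) pᵢx≡pⱼy ⟨
      pow (e ∸ j) (pow i x)   ≡⟨ pow-+ i (e ∸ j) x ⟨
      pow m x                 ∎

-- An element of order pq forces large classes

module _ {n} (Γ : SimpleGraph n) where

  LargeClasses : ℕ → ℕ → Set
  LargeClasses p q = (∃ λ a → p + q ≤ classSize Γ a)
                   ⊎ (∃₂ λ a b → ¬ StructEq Γ a b × p ≤ classSize Γ a × q ≤ classSize Γ b)

  module _ {σ} (σ∈SEP : InSEP Γ σ) where

    pow-structEq : ∀ i x → StructEq Γ x (pow σ i x)
    pow-structEq zero    x = structEq-refl Γ x
    pow-structEq (suc i) x =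
      structEq-trans Γ (InSEP⇒PreservesClasses Γ σ∈SEP x) (pow-structEq i (σ ⟨$⟩ʳ x))

    orbit-structEq : ∀ x d → All (StructEq Γ x) (orbit σ x d)
    orbit-structEq x d = All.applyUpTo⁺₂ _ d (λ i → pow-structEq i x)

    period≤classSize : ∀ {x d} → IsPeriod σ x d → d ≤ classSize Γ x
    period≤classSize {x} {d} per = subst (_≤ classSize Γ x) (length-applyUpTo _ d)
      (length≤classSize Γ (orbit-unique σ per) (orbit-structEq x d))

    disjoint-periods≤classSize : ∀ {x y d e} → IsPeriod σ x d → IsPeriod σ y e → StructEq Γ x y →
                                 Disjoint (orbit σ x d) (orbit σ y e) → d + e ≤ classSize Γ x
    disjoint-periods≤classSize {x} {y} {d} {e} perx pery x~y disj =
      subst (_≤ classSize Γ x) len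
        (length≤classSize Γ (Unique.++⁺ (orbit-unique σ perx) (orbit-unique σ pery) disj)
          (All.++⁺ (orbit-structEq x d) (All.map (structEq-trans Γ x~y) (orbit-structEq y e))))
      where
      len : length (orbit σ x d ++ orbit σ y e) ≡ d + e
      len = trans (length-++ (orbit σ x d)) (cong₂ _+_ (length-applyUpTo _ d) (length-applyUpTo _ e))

    -- The period of a point moved by σ^q divides pq but not q.
    prime-∣-period : ∀ {p q} → Prime p → Prime q → HasOrder σ (p * q) → ∃₂ λ x d → IsPeriod σ x d × p ∣ d
    prime-∣-period {p} {q} pp pq ord@(0<pq , pq-fixes , _)
      with hasOrder⇒moved σ ord (≤-trans (s≤s z≤n) (prime⇒2≤ pq)) q<pq
      where q<pq = subst (q <_) (*-comm q p) (m<m*n q p {{prime⇒nonZero pq}} (prime⇒2≤ pp))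
    ... | x , qx≢x with period-exists σ 0<pq (pq-fixes x)
    ... | d , per@(_ , d-fx , _) with ∣m*p⇒∣m⊎p∣ pp (subst (d ∣_) (*-comm p q) (period-∣ σ per (pq-fixes x)))
    ...   | inj₁ d∣q = contradiction (pow-∣-fixed σ d-fx {q} d∣q) qx≢x
    ...   | inj₂ p∣d = x , d , per , p∣d

    orbits-disjoint : ∀ {x y d e} → IsPeriod σ x d → IsPeriod σ y e → ¬ e ∣ d →
                      Disjoint (orbit σ x d) (orbit σ y e)
    orbits-disjoint {x} {y} {d} (_ , d-fx , _) pery@(_ , e-fy , _) e∤d (v∈x , v∈y)
      with ∈-applyUpTo⁻ (λ i → pow σ i x) v∈x | ∈-applyUpTo⁻ (λ j → pow σ j y) v∈y
    ... | i , _ , refl | j , j<e , pᵢx≡pⱼy =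
      e∤d (period-∣ σ pery (meeting-orbits-fixed σ {d = d} {i = i} d-fx e-fy j<e pᵢx≡pⱼy))

    elementOfOrder⇒LargeClasses : ∀ {p q} → Prime p → Prime q → p ≢ q → HasOrder σ (p * q) →
                                  LargeClasses p q
    elementOfOrder⇒LargeClasses {p} {q} pp pq p≢q ord
      with prime-∣-period pp pq ord | prime-∣-period pq pp (subst (HasOrder σ) (*-comm p q) ord)
    ... | x , d , perx@(0<d , _) , p∣d | y , e , pery@(0<e , _) , q∣e with structEq? Γ x y
    ...   | no x≁y = inj₂ (x , y , x≁y , ≤-trans (∣⇒≤ {{>-nonZero 0<d}} p∣d) (period≤classSize perx)
                                       , ≤-trans (∣⇒≤ {{>-nonZero 0<e}} q∣e) (period≤classSize pery))
    ...   | yes x~y with q ∣? d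
    ...     | yes q∣d = inj₁ (x , (begin
      p + q        ≤⟨ m+n≤m*n (prime⇒2≤ pp) (prime⇒2≤ pq) ⟩
      p * q        ≤⟨ ∣⇒≤ {{>-nonZero 0<d}} (distinct-primes-∣⇒*-∣ pp pq p≢q p∣d q∣d) ⟩
      d            ≤⟨ period≤classSize perx ⟩
      classSize Γ x ∎))
      where open ≤-Reasoning
    ...     | no q∤d = inj₁ (x , (begin
      p + q        ≤⟨ +-mono-≤ (∣⇒≤ {{>-nonZero 0<d}} p∣d) (∣⇒≤ {{>-nonZero 0<e}} q∣e) ⟩
      d + e        ≤⟨ disjoint-periods≤classSize perx pery x~y
                          (orbits-disjoint perx pery (q∤d ∘ ∣-trans q∣e)) ⟩
      classSize Γ x ∎))
      where open ≤-Reasoning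

-- Cycles built from transpositions

Chain : {A : Set} → (A → A) → A → List A → Set
Chain h z []       = ⊤
Chain h z (x ∷ xs) = h z ≡ x × Chain h x xs

module _ {A : Set} where

  chain-agree : ∀ {h h′ : A → A} {a a′} L e → h a′ ≡ h′ a → All (λ v → h v ≡ h′ v) L →
                Chain h′ a (L ++ [ e ]) → Chain h a′ (L ++ [ e ])
  chain-agree []      e ha′≡h′a []          (h′a≡e , _)  = trans ha′≡h′a h′a≡e , tt
  chain-agree (l ∷ L) e ha′≡h′a (hl≡h′l ∷ ag) (h′a≡l , ch) =
    trans ha′≡h′a h′a≡l , chain-agree L e hl≡h′l ag ch

  chain-image : ∀ {h : A → A} z L e → Chain h z (L ++ [ e ]) → All (λ w → h w ∈ L ++ [ e ]) (z ∷ L)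
  chain-image z []      e (hz≡e , _)  = here hz≡e ∷ []
  chain-image z (l ∷ L) e (hz≡l , ch) = here hz≡l ∷ All.map there (chain-image l L e ch)

module _ {n} (σ : Permutation′ n) where

  private
    chain-pow-∈ : ∀ z L e → Chain (σ ⟨$⟩ʳ_) z (L ++ [ e ]) → ∀ j → j < length L →
                  pow σ (suc j) z ∈ L
    chain-pow-∈ z (l ∷ L) e (σz≡l , ch) zero    _         rewrite σz≡l = here refl
    chain-pow-∈ z (l ∷ L) e (σz≡l , ch) (suc j) (s≤s j<L) rewrite σz≡l =
      there (chain-pow-∈ l L e ch j j<L)

    chain-pow-last : ∀ z L e → Chain (σ ⟨$⟩ʳ_) z (L ++ [ e ]) → pow σ (suc (length L)) z ≡ e
    chain-pow-last z []      e (σz≡e , _)  = σz≡e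
    chain-pow-last z (l ∷ L) e (σz≡l , ch) rewrite σz≡l = chain-pow-last l L e ch

    chain-reach : ∀ z L → Chain (σ ⟨$⟩ʳ_) z L → ∀ {w} → w ∈ z ∷ L → ∃ λ j → pow σ j z ≡ w
    chain-reach z L       _           (here refl) = 0 , refl
    chain-reach z (l ∷ L) (σz≡l , ch) (there w∈L) with chain-reach l L ch w∈L
    ... | j , pⱼl≡w = suc j , trans (cong (pow σ j) σz≡l) pⱼl≡w

  -- σ contains the cycle (x₀ x₁ … xₘ), where xs = x₁ … xₘ.
  module Cycle {x₀ xs} (x₀∉xs : x₀ ∉ xs) (chain : Chain (σ ⟨$⟩ʳ_) x₀ (xs ++ [ x₀ ])) where

    cycle-period : IsPeriod σ x₀ (suc (length xs))
    cycle-period = s≤s z≤n , chain-pow-last x₀ xs x₀ chain , moves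
      where
      moves : ∀ r → 0 < r → r < suc (length xs) → pow σ r x₀ ≢ x₀
      moves (suc j) _ (s≤s j<) pⱼx₀≡x₀ =
        x₀∉xs (subst (_∈ xs) pⱼx₀≡x₀ (chain-pow-∈ x₀ xs x₀ chain j j<))

    cycle-returns : ∀ {w} → w ∈ x₀ ∷ xs → pow σ (suc (length xs)) w ≡ w
    cycle-returns {w} w∈ with chain-reach x₀ (xs ++ [ x₀ ]) chain (∈-init w∈)
      where
      ∈-init : w ∈ x₀ ∷ xs → w ∈ x₀ ∷ xs ++ [ x₀ ]
      ∈-init (here w≡x₀) = here w≡x₀
      ∈-init (there w∈xs) = there (∈-++⁺ˡ w∈xs)
    ... | j , refl =
      trans (pow-comm σ (suc (length xs)) j x₀) (cong (pow σ j) (proj₁ (proj₂ cycle-period)))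

  cycle-hasOrder : ∀ {x₀ xs} → x₀ ∉ xs → Chain (σ ⟨$⟩ʳ_) x₀ (xs ++ [ x₀ ]) →
                   (∀ z → z ∉ x₀ ∷ xs → σ ⟨$⟩ʳ z ≡ z) → HasOrder σ (suc (length xs))
  cycle-hasOrder {x₀} {xs} x₀∉xs chain fixed =
    hasOrder-intro σ (s≤s z≤n) returns (λ j _ j-fixes → period-∣ σ cycle-period (j-fixes x₀))
    where
    open Cycle x₀∉xs chain
    returns : ∀ w → pow σ (suc (length xs)) w ≡ w
    returns w with Any.any? (w ≟_) (x₀ ∷ xs)
    ... | yes w∈ = cycle-returns w∈
    ... | no w∉  = pow-fixed σ (fixed w w∉) (suc (length xs))

  twoCycles-hasOrder : ∀ {x₀ xs y₀ ys} → x₀ ∉ xs → y₀ ∉ ys →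
    Chain (σ ⟨$⟩ʳ_) x₀ (xs ++ [ x₀ ]) → Chain (σ ⟨$⟩ʳ_) y₀ (ys ++ [ y₀ ]) →
    (∀ z → z ∉ x₀ ∷ xs → z ∉ y₀ ∷ ys → σ ⟨$⟩ʳ z ≡ z) →
    Prime (suc (length xs)) → Prime (suc (length ys)) → suc (length xs) ≢ suc (length ys) →
    HasOrder σ (suc (length xs) * suc (length ys))
  twoCycles-hasOrder {x₀} {xs} {y₀} {ys} x₀∉xs y₀∉ys chainX chainY fixed pP pQ P≢Q =
    hasOrder-intro σ (s≤s z≤n) returns
      (λ j _ j-fixes → distinct-primes-∣⇒*-∣ pP pQ P≢Q
        (period-∣ σ X.cycle-period (j-fixes x₀)) (period-∣ σ Y.cycle-period (j-fixes y₀)))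
    where
    P = suc (length xs)
    Q = suc (length ys)
    module X = Cycle x₀∉xs chainX
    module Y = Cycle y₀∉ys chainY
    returns : ∀ w → pow σ (P * Q) w ≡ w
    returns w with Any.any? (w ≟_) (x₀ ∷ xs) | Any.any? (w ≟_) (y₀ ∷ ys)
    ... | yes w∈X | _       =
      trans (cong (λ m → pow σ m w) (*-comm P Q)) (pow-*-fixed σ {P} (X.cycle-returns w∈X) Q)
    ... | no _    | yes w∈Y = pow-*-fixed σ {Q} (Y.cycle-returns w∈Y) P
    ... | no w∉X  | no w∉Y  = pow-fixed σ (fixed w w∉X w∉Y) (P * Q)

module _ {n : ℕ} where

  cycle : Fin n → List (Fin n) → Fin n → Fin n
  cycle x₀ []       z = z
  cycle x₀ (x ∷ xs) z = cycle x₀ xs (PC.transpose x₀ x z)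

  cycle-fixes : ∀ {x₀} xs {z} → z ∉ x₀ ∷ xs → cycle x₀ xs z ≡ z
  cycle-fixes []       _   = refl
  cycle-fixes (x ∷ xs) z∉ = trans
    (cong (cycle _ xs) (transpose-mismatch (z∉ ∘ here) (z∉ ∘ there ∘ here)))
    (cycle-fixes xs λ { (here z≡x₀) → z∉ (here z≡x₀) ; (there z∈xs) → z∉ (there (there z∈xs)) })

  cycle-chain : ∀ {x₀} xs → x₀ ∉ xs → Unique xs → Chain (cycle x₀ xs) x₀ (xs ++ [ x₀ ])
  cycle-chain     []        _     _             = refl , tt
  cycle-chain {x₀} (x₁ ∷ xs) x₀∉ (x₁∉xs ∷ xs!) =
    trans (cong (cycle x₀ xs) (transpose-matchˡ x₀ x₁)) (cycle-fixes xs x₁∉) ,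
    chain-agree xs x₀ (cong (cycle x₀ xs) (transpose-matchʳ x₀ x₁)) agree
      (cycle-chain xs (x₀∉ ∘ there) xs!)
    where
    x₁∉ : x₁ ∉ x₀ ∷ xs
    x₁∉ (here x₁≡x₀)  = x₀∉ (here (sym x₁≡x₀))
    x₁∉ (there x₁∈xs) = All¬⇒¬Any x₁∉xs x₁∈xs
    agree : All (λ v → cycle x₀ (x₁ ∷ xs) v ≡ cycle x₀ xs v) xs
    agree = All.tabulate λ {v} v∈xs → cong (cycle x₀ xs)
      (transpose-mismatch (λ v≡x₀ → x₀∉ (there (subst (_∈ xs) v≡x₀ v∈xs)))
                          (λ v≡x₁ → All.lookup x₁∉xs v∈xs (sym v≡x₁)))

  appendCycle : Permutation′ n → Fin n → List (Fin n) → Permutation′ n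
  appendCycle σ x₀ []       = σ
  appendCycle σ x₀ (x ∷ xs) = appendCycle (σ ∘ₚ transpose x₀ x) x₀ xs

  appendCycle-⟨$⟩ʳ : ∀ σ x₀ xs z → appendCycle σ x₀ xs ⟨$⟩ʳ z ≡ cycle x₀ xs (σ ⟨$⟩ʳ z)
  appendCycle-⟨$⟩ʳ σ x₀ []       z = refl
  appendCycle-⟨$⟩ʳ σ x₀ (x ∷ xs) z = appendCycle-⟨$⟩ʳ (σ ∘ₚ transpose x₀ x) x₀ xs z

  appendCycle-InSEP : ∀ (Γ : SimpleGraph n) {σ x₀ xs} → InSEP Γ σ → All (StructEq Γ x₀) xs →
                      InSEP Γ (appendCycle σ x₀ xs)
  appendCycle-InSEP Γ σ∈SEP []              = σ∈SEP
  appendCycle-InSEP Γ σ∈SEP (x₀~x ∷ x₀~xs) = appendCycle-InSEP Γ (sep-step _ _ x₀~x σ∈SEP) x₀~xs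

module _ {n} (Γ : SimpleGraph n) where

  private
    structEq-head : ∀ {c x₀ xs} → All (StructEq Γ c) (x₀ ∷ xs) → All (StructEq Γ x₀) xs
    structEq-head (c~x₀ ∷ c~xs) = All.map (structEq-trans Γ (structEq-sym Γ c~x₀)) c~xs

  cycle∈SEP : ∀ {c X} → Unique X → All (StructEq Γ c) X → 0 < length X →
              ∃ λ τ → InSEP Γ τ × HasOrder τ (length X)
  cycle∈SEP {X = x₀ ∷ xs} (x₀∉xs ∷ xs!) c~X _ =
    τ , appendCycle-InSEP Γ sep-id (structEq-head c~X) ,
    cycle-hasOrder τ x₀∉
      (chain-agree xs x₀ (acts x₀) (All.tabulate (λ _ → acts _)) (cycle-chain xs x₀∉ xs!))
      (λ z z∉ → trans (acts z) (cycle-fixes xs z∉))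
    where
    τ = appendCycle idₚ x₀ xs
    acts : ∀ z → τ ⟨$⟩ʳ z ≡ cycle x₀ xs z
    acts = appendCycle-⟨$⟩ʳ idₚ x₀ xs
    x₀∉ : x₀ ∉ xs
    x₀∉ = All¬⇒¬Any x₀∉xs

  twoCycles∈SEP : ∀ {p q c d X Y} → Prime p → Prime q → p ≢ q → length X ≡ p → length Y ≡ q →
                  Unique X → Unique Y → Disjoint X Y → All (StructEq Γ c) X → All (StructEq Γ d) Y →
                  ∃ λ ρ → InSEP Γ ρ × HasOrder ρ (p * q)
  twoCycles∈SEP {X = []} pP _ _ refl _ _ _ _ _ _ = contradiction (prime⇒2≤ pP) λ ()
  twoCycles∈SEP {Y = []} _ pQ _ _ refl _ _ _ _ _ = contradiction (prime⇒2≤ pQ) λ ()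
  twoCycles∈SEP {X = x₀ ∷ xs} {y₀ ∷ ys} pP pQ P≢Q refl refl (x₀∉xs ∷ xs!) (y₀∉ys ∷ ys!)
                disjoint c~X d~Y =
    ρ , appendCycle-InSEP Γ (appendCycle-InSEP Γ sep-id (structEq-head c~X)) (structEq-head d~Y) ,
    twoCycles-hasOrder ρ x₀∉ y₀∉ chainX chainY fixed pP pQ P≢Q
    where
    ρ = appendCycle (appendCycle idₚ x₀ xs) y₀ ys
    x₀∉ = All¬⇒¬Any x₀∉xs
    y₀∉ = All¬⇒¬Any y₀∉ys
    acts : ∀ z → ρ ⟨$⟩ʳ z ≡ cycle y₀ ys (cycle x₀ xs z)
    acts z = trans (appendCycle-⟨$⟩ʳ _ y₀ ys z) (cong (cycle y₀ ys) (appendCycle-⟨$⟩ʳ idₚ x₀ xs z))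
    ∈X : ∀ {w} → w ∈ xs ++ [ x₀ ] → w ∈ x₀ ∷ xs
    ∈X w∈ with ∈-++⁻ xs w∈
    ... | inj₁ w∈xs        = there w∈xs
    ... | inj₂ (here w≡x₀) = here w≡x₀
    onX : All (λ w → ρ ⟨$⟩ʳ w ≡ cycle x₀ xs w) (x₀ ∷ xs)
    onX = All.map (λ {w} ρw∈ → trans (acts w) (cycle-fixes ys (λ ρw∈Y → disjoint (∈X ρw∈ , ρw∈Y))))
                  (chain-image x₀ xs x₀ (cycle-chain xs x₀∉ xs!))
    onY : All (λ w → ρ ⟨$⟩ʳ w ≡ cycle y₀ ys w) (y₀ ∷ ys)
    onY = All.tabulate λ {w} w∈Y →
      trans (acts w) (cong (cycle y₀ ys) (cycle-fixes xs (λ w∈X → disjoint (w∈X , w∈Y))))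
    chainX = chain-agree xs x₀ (All.head onX) (All.tail onX) (cycle-chain xs x₀∉ xs!)
    chainY = chain-agree ys y₀ (All.head onY) (All.tail onY) (cycle-chain ys y₀∉ ys!)
    fixed : ∀ z → z ∉ x₀ ∷ xs → z ∉ y₀ ∷ ys → ρ ⟨$⟩ʳ z ≡ z
    fixed z z∉X z∉Y =
      trans (acts z) (trans (cong (cycle y₀ ys) (cycle-fixes xs z∉X)) (cycle-fixes ys z∉Y))

  LargeClasses⇒elementOfOrder : ∀ {p q} → Prime p → Prime q → p ≢ q → LargeClasses Γ p q →
                                ∃ λ ρ → InSEP Γ ρ × HasOrder ρ (p * q)
  LargeClasses⇒elementOfOrder {p} {q} pp pq p≢q (inj₁ (a , p+q≤)) =
    twoCycles∈SEP pp pq p≢q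
      (length-take-≤ (m+n≤o⇒m≤o p p+q≤))
      (length-take-≤ (subst (q ≤_) (sym (length-drop p (class Γ a)))
        (m+n≤o⇒m≤o∸n q (subst (_≤ classSize Γ a) (+-comm p q) p+q≤))))
      (Unique.take⁺ p (class-unique Γ a)) (Unique.take⁺ q (Unique.drop⁺ p (class-unique Γ a)))
      (λ (v∈X , v∈Y) → take-drop-disjoint p (class-unique Γ a) (v∈X , ∈-take⁻ q v∈Y))
      (All.take⁺ p (class-structEq Γ a)) (All.take⁺ q (All.drop⁺ p (class-structEq Γ a)))
  LargeClasses⇒elementOfOrder {p} {q} pp pq p≢q (inj₂ (a , b , a≁b , p≤a , q≤b)) =
    twoCycles∈SEP pp pq p≢q (length-take-≤ p≤a) (length-take-≤ q≤b)
      (Unique.take⁺ p (class-unique Γ a)) (Unique.take⁺ q (class-unique Γ b))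
      (λ (v∈X , v∈Y) →
        a≁b (structEq-trans Γ (All.lookup a~X v∈X) (structEq-sym Γ (All.lookup b~Y v∈Y))))
      a~X b~Y
    where
    a~X = All.take⁺ p (class-structEq Γ a)
    b~Y = All.take⁺ q (class-structEq Γ b)

-- The order of SEP(Γ)

module FreeAction {c ℓ} (S : Setoid c ℓ) (_≟ₛ_ : Decidable (Setoid._≈_ S))
                  (f : Setoid.Carrier S → Setoid.Carrier S)
                  (f-cong : ∀ {x y} → Setoid._≈_ S x y → Setoid._≈_ S (f x) (f y)) where

  open Setoid S using ()
    renaming (_≈_ to _≈ₛ_; Carrier to C; refl to ≈-refl; sym to ≈-sym; trans to ≈-trans; reflexive to ≈-reflexive)
  open SetoidMembership S using () renaming (_∈_ to _∈ₛ_; _∉_ to _∉ₛ_)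
  open SetoidUnique S using () renaming (Unique to Uniqueₛ)

  iter : ℕ → C → C
  iter zero    x = x
  iter (suc k) x = iter k (f x)

  iter-+ : ∀ a b x → iter (a + b) x ≡ iter b (iter a x)
  iter-+ zero    b x = refl
  iter-+ (suc a) b x = iter-+ a b (f x)

  iter-cong : ∀ k {x y} → x ≈ₛ y → iter k x ≈ₛ iter k y
  iter-cong zero    x≈y = x≈y
  iter-cong (suc k) x≈y = iter-cong k (f-cong x≈y)

  module _ (m : ℕ) (period : ∀ x → iter (suc m) x ≈ₛ x)
           (free : ∀ x j → 0 < j → j < suc m → ¬ iter j x ≈ₛ x) where

    orbitOf : C → List C
    orbitOf x = applyUpTo (λ i → iter i x) (suc m)

    orbitOf-unique : ∀ x → Uniqueₛ (orbitOf x)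
    orbitOf-unique x = SetoidUniqueProps.applyUpTo⁺₁ S _ (suc m) λ {i} {j} i<j j<P iᵢ≈iⱼ →
      free (iter i x) (j ∸ i) (m<n⇒0<n∸m i<j) (≤-<-trans (m∸n≤m j i) j<P) (≈-trans (≈-reflexive (begin
        iter (j ∸ i) (iter i x) ≡⟨ iter-+ i (j ∸ i) x ⟨
        iter (i + (j ∸ i)) x    ≡⟨ cong (λ k → iter k x) (m+[n∸m]≡n (<⇒≤ i<j)) ⟩
        iter j x                ∎)) (≈-sym iᵢ≈iⱼ))
      where open ≡-Reasoning

    ∈-orbitOf : ∀ x {i} → i < suc m → iter i x ∈ₛ orbitOf x
    ∈-orbitOf x = SetoidMembershipProps.∈-applyUpTo⁺ S (λ i → iter i x)

    f⁻¹-orbitOf : ∀ {x y} → f y ∈ₛ orbitOf x → y ∈ₛ orbitOf x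
    f⁻¹-orbitOf {x} {y} fy∈ with SetoidMembershipProps.∈-applyUpTo⁻ S (λ i → iter i x) fy∈
    ... | i , i<P , fy≈iᵢx = SetoidMembershipProps.∈-resp-≈ S (≈-sym y≈) (back i i<P)
      where
      y≈ : y ≈ₛ iter m (iter i x)
      y≈ = ≈-trans (≈-sym (period y)) (iter-cong m fy≈iᵢx)
      back : ∀ i → i < suc m → iter m (iter i x) ∈ₛ orbitOf x
      back zero     _         = ∈-orbitOf x ≤-refl
      back (suc i′) (s≤s i′<m) = SetoidMembershipProps.∈-resp-≈ S (≈-sym (≈-trans (≈-reflexive (begin
        iter m (iter (suc i′) x)      ≡⟨ iter-+ (suc i′) m x ⟨
        iter (suc i′ + m) x           ≡⟨ cong (λ k → iter k x) (sym (+-suc i′ m)) ⟩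
        iter (i′ + suc m) x           ≡⟨ iter-+ i′ (suc m) x ⟩
        iter (suc m) (iter i′ x)      ∎)) (period (iter i′ x))))
        (∈-orbitOf x (m≤n⇒m≤1+n i′<m))
        where open ≡-Reasoning

    private
      iter-closed : ∀ {xs} → (∀ {y} → y ∈ₛ xs → f y ∈ₛ xs) → ∀ i {y} → y ∈ₛ xs → iter i y ∈ₛ xs
      iter-closed closed zero    y∈ = y∈
      iter-closed closed (suc i) y∈ = iter-closed closed i (closed y∈)

    -- Removing the orbit of the first element, which lies inside xs and has exactly suc m
    -- elements, leaves a shorter closed list.
    closed⇒∣length : ∀ fuel xs → length xs ≤ fuel → Uniqueₛ xs → (∀ {y} → y ∈ₛ xs → f y ∈ₛ xs) →
                     suc m ∣ length xs
    closed⇒∣length _          []           _    _   _      = divides 0 refl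
    closed⇒∣length (suc fuel) xs@(x ∷ _) len≤ xs! closed =
      subst (suc m ∣_) (length-filter-∁ inO? xs) (∣m∣n⇒∣m+n (subst (suc m ∣_) (sym |inside|≡P) ∣-refl)
        (closed⇒∣length fuel outside |outside|≤ (SetoidUniqueProps.filter⁺ S (∁? inO?) xs!) outside-closed))
      where
      inO? : U.Decidable (_∈ₛ orbitOf x)
      inO? y = Any.any? (y ≟ₛ_) (orbitOf x)
      resp : ∀ {y z} → y ≈ₛ z → y ∈ₛ orbitOf x → z ∈ₛ orbitOf x
      resp = SetoidMembershipProps.∈-resp-≈ S
      respᶜ : ∀ {y z} → y ≈ₛ z → y ∉ₛ orbitOf x → z ∉ₛ orbitOf x
      respᶜ y≈z y∉ z∈ = y∉ (resp (≈-sym y≈z) z∈)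
      inside = filter inO? xs
      outside = filter (∁? inO?) xs
      |inside|≡P : length inside ≡ suc m
      |inside|≡P = ≤-antisym
        (subst (length inside ≤_) (length-applyUpTo (λ i → iter i x) (suc m))
          (Unique⇒length-mono-⊆ S (SetoidUniqueProps.filter⁺ S inO? xs!)
            (proj₂ ∘ SetoidMembershipProps.∈-filter⁻ S inO? resp)))
        (subst (_≤ length inside) (length-applyUpTo (λ i → iter i x) (suc m))
          (Unique⇒length-mono-⊆ S (orbitOf-unique x) λ {y} y∈O →
            SetoidMembershipProps.∈-filter⁺ S inO? resp (y∈xs y∈O) y∈O))
        where
        y∈xs : ∀ {y} → y ∈ₛ orbitOf x → y ∈ₛ xs
        y∈xs y∈O with SetoidMembershipProps.∈-applyUpTo⁻ S (λ i → iter i x) y∈O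
        ... | i , _ , y≈ = resp′ (≈-sym y≈) (iter-closed closed i (here ≈-refl))
          where resp′ = SetoidMembershipProps.∈-resp-≈ S
      |outside|≤ : length outside ≤ fuel
      |outside|≤ = ≤-pred (≤-trans (subst (suc (length outside) ≤_) (length-filter-∁ inO? xs)
        (+-monoˡ-≤ (length outside) (subst (1 ≤_) (sym |inside|≡P) (s≤s z≤n)))) len≤)
      outside-closed : ∀ {y} → y ∈ₛ outside → f y ∈ₛ outside
      outside-closed y∈ with SetoidMembershipProps.∈-filter⁻ S (∁? inO?) respᶜ y∈
      ... | y∈xs , y∉O = SetoidMembershipProps.∈-filter⁺ S (∁? inO?) respᶜ (closed y∈xs) (y∉O ∘ f⁻¹-orbitOf)

PermSetoid : ℕ → Setoid 0ℓ 0ℓ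
PermSetoid n = record
  { Carrier       = Permutation′ n
  ; _≈_           = _≈_
  ; isEquivalence = record
    { refl  = λ _ → refl
    ; sym   = λ π≈ρ i → sym (π≈ρ i)
    ; trans = λ π≈ρ ρ≈τ i → trans (π≈ρ i) (ρ≈τ i)
    }
  }

_≈?_ : ∀ {n} → Decidable (_≈_ {n} {n})
σ ≈? τ = all? λ i → σ ⟨$⟩ʳ i ≟ τ ⟨$⟩ʳ i

perms : ∀ n → List (Permutation′ n)
perms zero    = idₚ ∷ []
perms (suc n) = cartesianProductWith (insert zero) (allFin (suc n)) (perms n)

module _ {n : ℕ} where

  insert-cong : ∀ {j j′ : Fin (suc n)} {π π′ : Permutation′ n} → j ≡ j′ → π ≈ π′ →
                insert zero j π ≈ insert zero j′ π′
  insert-cong refl π≈π′ zero    = refl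
  insert-cong {j} {_} {π} {π′} refl π≈π′ (suc k) =
    trans (insert-punchIn zero j π k) (trans (cong (punchIn j) (π≈π′ k)) (sym (insert-punchIn zero j π′ k)))

  insert-injective : ∀ {j j′ : Fin (suc n)} {π π′ : Permutation′ n} → insert zero j π ≈ insert zero j′ π′ →
                     j ≡ j′ × π ≈ π′
  insert-injective {j} {j′} {π} {π′} eq = j≡j′ , λ k → punchIn-injective j _ _ (begin
      punchIn j (π ⟨$⟩ʳ k)       ≡⟨ insert-punchIn zero j π k ⟨
      insert zero j π ⟨$⟩ʳ suc k  ≡⟨ eq (suc k) ⟩
      insert zero j′ π′ ⟨$⟩ʳ suc k ≡⟨ insert-punchIn zero j′ π′ k ⟩
      punchIn j′ (π′ ⟨$⟩ʳ k)     ≡⟨ cong (λ i → punchIn i (π′ ⟨$⟩ʳ k)) j≡j′ ⟨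
      punchIn j (π′ ⟨$⟩ʳ k)      ∎)
    where
    open ≡-Reasoning
    j≡j′ = eq zero

perms-complete : ∀ n (σ : Permutation′ n) → Any (σ ≈_) (perms n)
perms-complete zero    σ = here λ ()
perms-complete (suc n) σ =
  SetoidMembershipProps.∈-resp-≈ (PermSetoid (suc n)) {x = σ′} {σ} (insert-remove zero σ)
    (SetoidMembershipProps.∈-cartesianProductWith⁺ (setoid (Fin (suc n))) (PermSetoid n) (PermSetoid (suc n))
      {insert zero} insert-cong (∈-allFin (σ ⟨$⟩ʳ zero)) (perms-complete n (remove zero σ)))
  where σ′ = insert zero (σ ⟨$⟩ʳ zero) (remove zero σ)

perms-unique : ∀ n → AllPairs (λ σ τ → ¬ σ ≈ τ) (perms n)
perms-unique zero    = [] ∷ []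
perms-unique (suc n) =
  SetoidUniqueProps.cartesianProductWith⁺ (setoid (Fin (suc n))) (PermSetoid n) (PermSetoid (suc n))
    (insert zero) insert-injective (Unique.allFin⁺ (suc n)) (perms-unique n)

module _ {n} (Γ : SimpleGraph n) where

  PreservesClasses⇒InSEP : ∀ σ → PreservesClasses Γ σ → ∃ λ ρ → InSEP Γ ρ × ρ ≈ σ
  PreservesClasses⇒InSEP σ pres = go (allFin n) {σ} pres (λ z z∉ → contradiction (∈-allFin z) z∉)
    where
    -- Induction on a list of points outside which σ is the identity: following σ by the
    -- transposition (x σx), which lies in SEP(Γ), removes x from the support.
    go : ∀ zs {σ} → PreservesClasses Γ σ → (∀ z → z ∉ zs → σ ⟨$⟩ʳ z ≡ z) →
         ∃ λ ρ → InSEP Γ ρ × ρ ≈ σ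
    go []       _ fixed = idₚ , sep-id , λ z → sym (fixed z λ ())
    go (x ∷ zs) {σ} pres fixed with go zs {σ ∘ₚ transpose x y} pres′ fixed′
      where
      y = σ ⟨$⟩ʳ x
      pres′ : PreservesClasses Γ (σ ∘ₚ transpose x y)
      pres′ z = structEq-trans Γ (pres z) (structEq-transpose Γ (pres x) (σ ⟨$⟩ʳ z))
      fixed′ : ∀ z → z ∉ zs → PC.transpose x y (σ ⟨$⟩ʳ z) ≡ z
      fixed′ z z∉zs with z ≟ x
      ... | yes refl = transpose-matchʳ x y
      ... | no z≢x   = trans (cong (PC.transpose x y) σz≡z) (transpose-mismatch z≢x z≢y)
        where
        σz≡z = fixed z λ { (here z≡x) → z≢x z≡x ; (there z∈zs) → z∉zs z∈zs }
        z≢y : z ≢ y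
        z≢y z≡y = z≢x (⟨$⟩ʳ-injective σ (trans σz≡z z≡y))
    ... | ρ , ρ∈SEP , ρ≈σ′ =
      ρ ∘ₚ transpose y x , sep-step y x (structEq-sym Γ (pres x)) ρ∈SEP ,
      λ z → trans (cong (PC.transpose y x) (ρ≈σ′ z)) (PC.transpose-inverse y x)
      where y = σ ⟨$⟩ʳ x

  preservesClasses? : ∀ σ → Dec (PreservesClasses Γ σ)
  preservesClasses? σ = all? λ x → structEq? Γ x (σ ⟨$⟩ʳ x)

  -- InSEP is not closed under _≈_, so each class-preserving permutation is replaced by an
  -- ≈-equal product of transpositions.
  representatives : List (Permutation′ n) → List (Permutation′ n)
  representatives []       = []
  representatives (π ∷ πs) with preservesClasses? π
  ... | yes pres = proj₁ (PreservesClasses⇒InSEP π pres) ∷ representatives πs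
  ... | no _     = representatives πs

  representatives-InSEP : ∀ πs → All (InSEP Γ) (representatives πs)
  representatives-InSEP []       = []
  representatives-InSEP (π ∷ πs) with preservesClasses? π
  ... | yes pres = proj₁ (proj₂ (PreservesClasses⇒InSEP π pres)) ∷ representatives-InSEP πs
  ... | no _     = representatives-InSEP πs

  representatives-complete : ∀ πs σ → PreservesClasses Γ σ → Any (σ ≈_) πs →
                             Any (σ ≈_) (representatives πs)
  representatives-complete (π ∷ πs) σ pres σ∈ with preservesClasses? π | σ∈
  ... | yes presπ | here σ≈π  =
    here λ i → trans (σ≈π i) (sym (proj₂ (proj₂ (PreservesClasses⇒InSEP π presπ)) i))
  ... | yes _     | there σ∈′ = there (representatives-complete πs σ pres σ∈′)
  ... | no ¬presπ | here σ≈π  = contradiction (λ x → subst (StructEq Γ x) (σ≈π x) (pres x)) ¬presπ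
  ... | no _      | there σ∈′ = representatives-complete πs σ pres σ∈′

  representatives-sound : ∀ πs → All (λ ρ → Any (ρ ≈_) πs) (representatives πs)
  representatives-sound []       = []
  representatives-sound (π ∷ πs) with preservesClasses? π
  ... | yes pres =
    here (proj₂ (proj₂ (PreservesClasses⇒InSEP π pres))) ∷ All.map there (representatives-sound πs)
  ... | no _     = All.map there (representatives-sound πs)

  representatives-unique : ∀ πs → AllPairs (λ σ τ → ¬ σ ≈ τ) πs →
                           AllPairs (λ σ τ → ¬ σ ≈ τ) (representatives πs)
  representatives-unique []       _            = []
  representatives-unique (π ∷ πs) (π≉πs ∷ πs!) with preservesClasses? π
  ... | yes pres = All.map (λ {ρ′} ρ′∈πs ρ≈ρ′ → distinct {ρ′} ρ′∈πs (λ i → trans (sym (ρ≈π i)) (ρ≈ρ′ i)))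
                           (representatives-sound πs)
                   ∷ representatives-unique πs πs!
    where
    ρ≈π = proj₂ (proj₂ (PreservesClasses⇒InSEP π pres))
    distinct : ∀ {ρ} → Any (ρ ≈_) πs → ¬ π ≈ ρ
    distinct ρ∈πs π≈ρ = All¬⇒¬Any π≉πs (Any.map (λ ρ≈τ i → trans (π≈ρ i) (ρ≈τ i)) ρ∈πs)
  ... | no _     = representatives-unique πs πs!

  sepList : List (Permutation′ n)
  sepList = representatives (perms n)

  sepList-enumerates : EnumeratesSEP Γ sepList
  sepList-enumerates =
    representatives-InSEP (perms n) ,
    (λ σ σ∈SEP → representatives-complete (perms n) σ (InSEP⇒PreservesClasses Γ σ∈SEP) (perms-complete n σ)) ,
    representatives-unique (perms n) (perms-unique n)

module _ {n} (Γ : SimpleGraph n) where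

  sepList-PreservesClasses : ∀ σ → Any (σ ≈_) (sepList Γ) → PreservesClasses Γ σ
  sepList-PreservesClasses σ σ∈ = All.lookupWith
    (λ ρ∈SEP σ≈ρ x → subst (StructEq Γ x) (sym (σ≈ρ x)) (InSEP⇒PreservesClasses Γ ρ∈SEP x))
    (proj₁ (sepList-enumerates Γ)) σ∈

  -- Lagrange's theorem for ⟨τ⟩: right multiplication by τ acts freely on SEP(Γ) with period m.
  hasOrder⇒DividesOrderSEP : ∀ {τ m} → InSEP Γ τ → HasOrder τ m → DividesOrderSEP Γ m
  hasOrder⇒DividesOrderSEP {τ} {suc m} τ∈SEP (_ , τᵐ≈id , minimal) =
    sepList Γ , sepList-enumerates Γ ,
    closed⇒∣length m period free (length (sepList Γ)) (sepList Γ) ≤-refl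
      (proj₂ (proj₂ (sepList-enumerates Γ))) (λ {σ} → closed {σ})
    where
    open FreeAction (PermSetoid n) _≈?_ (_∘ₚ τ) (λ σ≈σ′ i → cong (τ ⟨$⟩ʳ_) (σ≈σ′ i))
    iter-⟨$⟩ʳ : ∀ j σ z → iter j σ ⟨$⟩ʳ z ≡ pow τ j (σ ⟨$⟩ʳ z)
    iter-⟨$⟩ʳ zero    σ z = refl
    iter-⟨$⟩ʳ (suc j) σ z = iter-⟨$⟩ʳ j (σ ∘ₚ τ) z
    period : ∀ σ → iter (suc m) σ ≈ σ
    period σ z = trans (iter-⟨$⟩ʳ (suc m) σ z) (τᵐ≈id (σ ⟨$⟩ʳ z))
    free : ∀ σ j → 0 < j → j < suc m → ¬ iter j σ ≈ σ
    free σ j 0<j j<m στʲ≈σ = minimal j 0<j j<m λ z → begin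
      pow τ j z                     ≡⟨ cong (pow τ j) (inverseʳ σ) ⟨
      pow τ j (σ ⟨$⟩ʳ (σ ⟨$⟩ˡ z))   ≡⟨ iter-⟨$⟩ʳ j σ (σ ⟨$⟩ˡ z) ⟨
      iter j σ ⟨$⟩ʳ (σ ⟨$⟩ˡ z)      ≡⟨ στʲ≈σ (σ ⟨$⟩ˡ z) ⟩
      σ ⟨$⟩ʳ (σ ⟨$⟩ˡ z)             ≡⟨ inverseʳ σ ⟩
      z                             ∎
      where open ≡-Reasoning
    closed : ∀ {σ} → Any (σ ≈_) (sepList Γ) → Any ((σ ∘ₚ τ) ≈_) (sepList Γ)
    closed {σ} σ∈ = representatives-complete Γ (perms n) (σ ∘ₚ τ)
      (λ x → structEq-trans Γ (sepList-PreservesClasses σ σ∈ x)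
                              (InSEP⇒PreservesClasses Γ τ∈SEP (σ ⟨$⟩ʳ x)))
      (perms-complete n (σ ∘ₚ τ))

-- Counting primes

primeList : ℕ → List ℕ
primeList m = filter prime? (upTo m)

∈-primeList⁺ : ∀ {r m} → Prime r → r < m → r ∈ primeList m
∈-primeList⁺ pr r<m = ∈-filter⁺ prime? (∈-upTo⁺ r<m) pr

∈-primeList⁻ : ∀ {r m} → r ∈ primeList m → Prime r × r < m
∈-primeList⁻ r∈ with ∈-filter⁻ prime? r∈
... | r∈upTo , pr = pr , ∈-upTo⁻ r∈upTo

primeList-unique : ∀ m → Unique (primeList m)
primeList-unique m = Unique.filter⁺ prime? (Unique.upTo⁺ m)

length≤primesBelow : ∀ {rs m} → Unique rs → All (λ r → Prime r × r < m) rs → length rs ≤ primesBelow m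
length≤primesBelow rs! small = Unique⇒length-mono-⊆ (setoid ℕ) rs! λ r∈ →
  let pr , r<m = All.lookup small r∈ in ∈-primeList⁺ pr r<m

primesBelow-mono-≤ : ∀ {m m′} → m ≤ m′ → primesBelow m ≤ primesBelow m′
primesBelow-mono-≤ {m} m≤m′ = length≤primesBelow (primeList-unique m)
  (All.tabulate λ r∈ → let pr , r<m = ∈-primeList⁻ r∈ in pr , <-≤-trans r<m m≤m′)

prime⇒primesBelow-< : ∀ {r m} → Prime r → r < m → suc (primesBelow r) ≤ primesBelow m
prime⇒primesBelow-< {r} pr r<m = length≤primesBelow
  (All.tabulate (λ r′∈ r≡r′ → <-irrefl (sym r≡r′) (proj₂ (∈-primeList⁻ r′∈))) ∷ primeList-unique r)
  ((pr , r<m) ∷ All.tabulate λ r′∈ → let pr′ , r′<r = ∈-primeList⁻ r′∈ in pr′ , <-trans r′<r r<m)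

module _ {k pk pk₁} (pk-nth : IsNthPrime k pk) (pk₁-nth : IsNthPrime (k ∸ 1) pk₁) where

  private
    primesBelow-pk : suc (primesBelow pk) ≡ k
    primesBelow-pk = proj₂ pk-nth
    primesBelow-pk₁ : suc (primesBelow pk₁) ≡ primesBelow pk
    primesBelow-pk₁ = trans (proj₂ pk₁-nth) (cong (_∸ 1) (sym primesBelow-pk))

  nthPrime-pred< : pk₁ < pk
  nthPrime-pred< = ≰⇒> λ pk≤pk₁ →
    <-irrefl refl (≤-trans (≤-reflexive primesBelow-pk₁) (primesBelow-mono-≤ pk≤pk₁))

  prime≤nthPrime : ∀ {r} → Prime r → r ≤ pk → r ≡ pk ⊎ r ≤ pk₁
  prime≤nthPrime {r} pr r≤pk with m≤n⇒m<n∨m≡n r≤pk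
  ... | inj₂ r≡pk = inj₁ r≡pk
  ... | inj₁ r<pk = inj₂ (≮⇒≥ λ pk₁<r → <-irrefl refl (begin-strict
    primesBelow r          <⟨ prime⇒primesBelow-< pr r<pk ⟩
    primesBelow pk         ≡⟨ primesBelow-pk₁ ⟨
    suc (primesBelow pk₁)  ≤⟨ prime⇒primesBelow-< (proj₁ pk₁-nth) pk₁<r ⟩
    primesBelow r          ∎))
    where open ≤-Reasoning

  distinctPrimes⇒large : (f : Fin k → ℕ) → (∀ i → Prime (f i)) → (∀ {i j} → f i ≡ f j → i ≡ j) →
                         ∃₂ λ i j → i ≢ j × pk ≤ f i × pk₁ ≤ f j
  distinctPrimes⇒large f prime-f f-inj with all? (λ i → f i <? pk)
  ... | yes all<pk = contradiction (injection⇒≤length f f-inj λ i → ∈-primeList⁺ (prime-f i) (all<pk i))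
                                   (<⇒≱ (≤-reflexive primesBelow-pk))
  ... | no ¬all<pk with ¬∀⟶∃¬ k _ (λ i → f i <? pk) ¬all<pk
  ...   | i , fi≮pk with all? (λ j → (j ≟ i) ⊎-dec (f j <? pk₁))
  ...     | yes small = contradiction (injection⇒≤length f f-inj (λ j → ∈-small (small j)))
                                      (<⇒≱ (≤-reflexive (trans (cong suc primesBelow-pk₁) primesBelow-pk)))
    where
    ∈-small : ∀ {j} → j ≡ i ⊎ f j < pk₁ → f j ∈ f i ∷ primeList pk₁
    ∈-small (inj₁ refl) = here refl
    ∈-small (inj₂ fj<pk₁) = there (∈-primeList⁺ (prime-f _) fj<pk₁)
  ...     | no ¬small with ¬∀⟶∃¬ k _ (λ j → (j ≟ i) ⊎-dec (f j <? pk₁)) ¬small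
  ...       | j , ¬j-small = i , j , ¬j-small ∘ inj₁ ∘ sym , ≮⇒≥ fi≮pk , ≮⇒≥ (¬j-small ∘ inj₂)

nthPrime⇒primesUpTo : ∀ {k pk} → IsNthPrime k pk →
                      ∃ λ (f : Fin k → ℕ) → (∀ {i j} → f i ≡ f j → i ≡ j) × (∀ i → Prime (f i) × f i ≤ pk)
nthPrime⇒primesUpTo {pk = pk} (pk-prime , refl) =
  lookup primes , lookup-injective primes! , λ i → bounded (∈-lookup i)
  where
  primes = pk ∷ primeList pk
  primes! : Unique primes
  primes! = All.tabulate (λ r∈ pk≡r → <-irrefl (sym pk≡r) (proj₂ (∈-primeList⁻ r∈))) ∷ primeList-unique pk
  bounded : ∀ {r} → r ∈ primes → Prime r × r ≤ pk
  bounded (here refl) = pk-prime , ≤-refl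
  bounded (there r∈) = let pr , r<pk = ∈-primeList⁻ r∈ in pr , <⇒≤ r<pk

-- Cliques of the prime graph

module _ {n} (Γ : SimpleGraph n) where

  LargeClasses-mono : ∀ {p p′ q q′} → p′ ≤ p → q′ ≤ q → LargeClasses Γ p q → LargeClasses Γ p′ q′
  LargeClasses-mono p′≤p q′≤q (inj₁ (a , p+q≤)) = inj₁ (a , ≤-trans (+-mono-≤ p′≤p q′≤q) p+q≤)
  LargeClasses-mono p′≤p q′≤q (inj₂ (a , b , a≁b , p≤a , q≤b)) =
    inj₂ (a , b , a≁b , ≤-trans p′≤p p≤a , ≤-trans q′≤q q≤b)

  LargeClasses⇒classSize≥ : ∀ {p q} → LargeClasses Γ p q → ∃ λ a → p ≤ classSize Γ a
  LargeClasses⇒classSize≥ (inj₁ (a , p+q≤)) = a , m+n≤o⇒m≤o _ p+q≤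
  LargeClasses⇒classSize≥ (inj₂ (a , _ , _ , p≤a , _)) = a , p≤a

  prime≤classSize⇒DividesOrderSEP : ∀ {p a} → Prime p → p ≤ classSize Γ a → DividesOrderSEP Γ p
  prime≤classSize⇒DividesOrderSEP {p} {a} pp p≤a
    with cycle∈SEP Γ (Unique.take⁺ p (class-unique Γ a)) (All.take⁺ p (class-structEq Γ a))
                     (subst (0 <_) (sym (length-take-≤ p≤a)) (≤-trans (s≤s z≤n) (prime⇒2≤ pp)))
  ... | τ , τ∈SEP , ord = hasOrder⇒DividesOrderSEP Γ τ∈SEP (subst (HasOrder τ) (length-take-≤ p≤a) ord)

  module _ {k pk pk₁} (pk-nth : IsNthPrime k pk) (pk₁-nth : IsNthPrime (k ∸ 1) pk₁) where

    hasClique⇒LargeClasses : HasClique Γ k → LargeClasses Γ pk pk₁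
    hasClique⇒LargeClasses (f , vertex , edge)
      with distinctPrimes⇒large pk-nth pk₁-nth f (proj₁ ∘ vertex) f-injective
      where
      f-injective : ∀ {i j} → f i ≡ f j → i ≡ j
      f-injective {i} {j} fi≡fj with i ≟ j
      ... | yes i≡j = i≡j
      ... | no i≢j  = contradiction fi≡fj (proj₁ (edge i j i≢j))
    ... | i , j , i≢j , pk≤fi , pk₁≤fj with edge i j i≢j
    ...   | fi≢fj , σ , σ∈SEP , ord = LargeClasses-mono pk≤fi pk₁≤fj
      (elementOfOrder⇒LargeClasses Γ σ∈SEP (proj₁ (vertex i)) (proj₁ (vertex j)) fi≢fj ord)

    LargeClasses⇒hasClique : LargeClasses Γ pk pk₁ → HasClique Γ k
    LargeClasses⇒hasClique large with nthPrime⇒primesUpTo pk-nth | LargeClasses⇒classSize≥ large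
    ... | f , f-injective , bounded | a , pk≤a = f , vertex , edge
      where
      vertex : ∀ i → PGVertex Γ (f i)
      vertex i = proj₁ (bounded i) ,
                 prime≤classSize⇒DividesOrderSEP (proj₁ (bounded i)) (≤-trans (proj₂ (bounded i)) pk≤a)
      element : ∀ i j → f i ≢ f j → f j ≤ pk₁ → ∃ λ ρ → InSEP Γ ρ × HasOrder ρ (f i * f j)
      element i j fi≢fj fj≤pk₁ = LargeClasses⇒elementOfOrder Γ (proj₁ (bounded i)) (proj₁ (bounded j)) fi≢fj
        (LargeClasses-mono (proj₂ (bounded i)) fj≤pk₁ large)
      edge : ∀ i j → i ≢ j → PGEdge Γ (f i) (f j)
      edge i j i≢j with prime≤nthPrime pk-nth pk₁-nth (proj₁ (bounded j)) (proj₂ (bounded j))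
      ... | inj₂ fj≤pk₁ = fi≢fj , element i j fi≢fj fj≤pk₁
        where fi≢fj = i≢j ∘ f-injective
      ... | inj₁ fj≡pk with prime≤nthPrime pk-nth pk₁-nth (proj₁ (bounded i)) (proj₂ (bounded i))
      ...   | inj₁ fi≡pk = contradiction (f-injective (trans fi≡pk (sym fj≡pk))) i≢j
      ...   | inj₂ fi≤pk₁ with element j i (i≢j ∘ sym ∘ f-injective) fi≤pk₁
      ...     | ρ , ρ∈SEP , ord =
        i≢j ∘ f-injective , ρ , ρ∈SEP , subst (HasOrder ρ) (*-comm (f j) (f i)) ord

    hasClique⇔LargeClasses : HasClique Γ k ⇔ LargeClasses Γ pk pk₁
    hasClique⇔LargeClasses = mk⇔ hasClique⇒LargeClasses LargeClasses⇒hasClique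

module _ {n} (Γ : SimpleGraph n) where

  LargeClasses⇔largestClasses : ∀ {p q} → q ≤ p → ∀ {a b} → ¬ StructEq Γ a b →
    (∀ v → classSize Γ v ≤ classSize Γ a) → (∀ v → ¬ StructEq Γ a v → classSize Γ v ≤ classSize Γ b) →
    LargeClasses Γ p q ⇔ ((p + q ≤ classSize Γ a) ⊎ ((p ≤ classSize Γ a) × (q ≤ classSize Γ b)))
  LargeClasses⇔largestClasses {p} {q} q≤p {a} {b} a≁b a-max b-max = mk⇔ to from
    where
    to : LargeClasses Γ p q → (p + q ≤ classSize Γ a) ⊎ ((p ≤ classSize Γ a) × (q ≤ classSize Γ b))
    to (inj₁ (x , p+q≤x)) = inj₁ (≤-trans p+q≤x (a-max x))
    to (inj₂ (x , y , x≁y , p≤x , q≤y)) with structEq? Γ a x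
    ... | yes a~x = inj₂ (≤-trans p≤x (a-max x) ,
                          ≤-trans q≤y (b-max y (x≁y ∘ structEq-trans Γ (structEq-sym Γ a~x))))
    ... | no a≁x  = inj₂ (≤-trans p≤x (a-max x) , ≤-trans (≤-trans q≤p p≤x) (b-max x a≁x))
    from : (p + q ≤ classSize Γ a) ⊎ ((p ≤ classSize Γ a) × (q ≤ classSize Γ b)) → LargeClasses Γ p q
    from (inj₁ p+q≤a)        = inj₁ (a , p+q≤a)
    from (inj₂ (p≤a , q≤b)) = inj₂ (a , b , a≁b , p≤a , q≤b)

  LargeClasses⇔singleClass : ∀ {p q} a → (∀ u v → StructEq Γ u v) →
                             LargeClasses Γ p q ⇔ (p + q ≤ classSize Γ a)
  LargeClasses⇔singleClass {p} {q} a all~ = mk⇔ to (λ p+q≤a → inj₁ (a , p+q≤a))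
    where
    to : LargeClasses Γ p q → p + q ≤ classSize Γ a
    to (inj₁ (x , p+q≤x))           = subst (p + q ≤_) (classSize-resp Γ (all~ x a)) p+q≤x
    to (inj₂ (x , y , x≁y , _ , _)) = contradiction (all~ x y) x≁y

theorem3p2 : ∀ {n} (Γ : SimpleGraph n) (k pk pk₁ : ℕ) → 2 ≤ k →
    IsNthPrime k pk → IsNthPrime (k ∸ 1) pk₁ →
    (∀ (a b : Fin n) →
      ¬ StructEq Γ a b →
      (∀ v → classSize Γ v ≤ classSize Γ a) →
      (∀ v → ¬ StructEq Γ a v → classSize Γ v ≤ classSize Γ b) →
      HasClique Γ k ⇔ ((pk + pk₁ ≤ classSize Γ a) ⊎ ((pk ≤ classSize Γ a) × (pk₁ ≤ classSize Γ b))))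
    ×
    (∀ (a : Fin n) →
      (∀ u v → StructEq Γ u v) →
      HasClique Γ k ⇔ (pk + pk₁ ≤ classSize Γ a))
theorem3p2 Γ k pk pk₁ _ pk-nth pk₁-nth =
  (λ a b a≁b a-max b-max → ⇔-trans clique⇔large
     (LargeClasses⇔largestClasses Γ (<⇒≤ (nthPrime-pred< pk-nth pk₁-nth)) a≁b a-max b-max)) ,
  (λ a all~ → ⇔-trans clique⇔large (LargeClasses⇔singleClass Γ a all~))
  where
  clique⇔large = hasClique⇔LargeClasses Γ pk-nth pk₁-nth
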